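{- Let $G$ be a finite bipartite graph on $\Sigma_1=\{0,\dots,N-1\}$ with nonempty bipartition classes $V_1,V_2$, let $\hat G$ be obtained from $G$ by adding a set $RE(\hat G)$ of extra edges satisfying Property R, and let $\hat G_n$ be as in the context. Then there exist constants $K_1,K_2>0$ such that for every $n\ge1$ and every vertex $\underline x$ of $\hat G_n$, the local clustering coefficient $C_{\underline x}$ of $\underline x$ in $\hat G_n$ satisfies $$\frac{K_1}{\widehat{\deg}_n(\underline x)}\le C_{\underline x}\le\frac{K_2}{\widehat{\deg}_n(\underline x)},$$ where $\widehat{\deg}_n(\underline x)$ is the degree of $\underline x$ in $\hat G_n$.
   Context: Edge set $E(G)$; each edge joins $V_1$ to $V_2$. Property R: for every $x\in\Sigma_1$ there exist $y,z\in\Sigma_1$ such that two of the edges of the triangle $\{x,y,z\}$ belong to $E(G)$ and one belongs to $RE(\hat G)$. $\hat G$ has vertex set $\Sigma_1$ and edge set $E(G)\cup RE(\hat G)$ (no loops). $\mathrm{typ}(x)=i$ if $x\in V_i$; for a word over $\Sigma_1$, its type is $i$ if all letters lie in $V_i$, else $0$. For distinct $\underline x,\underline y\in\Sigma_n=\Sigma_1^n$ let $k$ be the length of their longest common prefix and $\tilde{\underline x},\tilde{\underline y}$ the remaining postfixes. $G_n'$ is the simple graph on $\Sigma_n$ in which distinct $\underline x,\underline y$ are adjacent iff $\{\mathrm{typ}(\tilde{\underline x}),\mathrm{typ}(\tilde{\underline y})\}=\{1,2\}$ and $\{x_i,y_i\}\in E(G)$ for all $k<i\le n$. $\hat G_n$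 is the simple graph on $\Sigma_n$ with edge set $E(G_n')\cup RE(\hat G_n)$, where $RE(\hat G_n)$ consists of the pairs $\{\underline x,\underline y\}$ with $x_i=y_i$ for $i\le n-1$ and $\{x_n,y_n\}\in RE(\hat G)$. The local clustering coefficient of a vertex $v$ with $n_v$ neighbours is $C_v=\#\{\text{edges between neighbours of }v\}/\binom{n_v}{2}$. -}

module Defs where

open import Data.Bool using (Bool; true; false; _∧_; _∨_; not; if_then_else_)
open import Data.Nat using (ℕ; zero; suc)
open import Data.Nat.Combinatorics using (_C_)
open import Data.Fin using (Fin)
import Data.Fin as Fin
open import Data.Vec using (Vec; []; _∷_)
import Data.Vec.Properties as VecP
open import Data.List using (List; []; _∷_; [_]; map; concatMap; allFin; filterᵇ; length; _++_)
open import Data.Product using (_×_; _,_)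
import Data.Product
open import Data.Integer using (+_)
open import Data.Rational using (ℚ; 0ℚ; _/_)
open import Relation.Nullary using (does)

-- Rational number e / m, with the convention e / 0 = 0.
_/ℚ_ : ℕ → ℕ → ℚ
e /ℚ zero = 0ℚ
e /ℚ suc m = (+ e) / suc m

invℕ : ℕ → ℚ
invℕ d = 1 /ℚ d

unorderedPairs : {A : Set} → List A → List (A × A)
unorderedPairs []       = []
unorderedPairs (a ∷ as) = map (λ b → (a , b)) as ++ unorderedPairs as

-- Data: alphabet Σ₁ = Fin N; part x = true iff x ∈ V₁ (false iff x ∈ V₂);
-- E = edge relation of G; RE = extra edges RE(Ĝ).
module Hat {N : ℕ} (part : Fin N → Bool) (E RE : Fin N → Fin N → Bool) where

  _==_ : Fin N → Fin N → Bool
  a == b = does (a Fin.≟ b)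

  Word : ℕ → Set
  Word n = Vec (Fin N) n

  allWords : (n : ℕ) → List (Word n)
  allWords zero    = [ [] ]
  allWords (suc n) = concatMap (λ a → map (a ∷_) (allWords n)) (allFin N)

  allV1 allV2 : {m : ℕ} → Word m → Bool
  allV1 []       = true
  allV1 (a ∷ w)  = part a ∧ allV1 w
  allV2 []       = true
  allV2 (a ∷ w)  = not (part a) ∧ allV2 w

  -- {typ(x̃), typ(ỹ)} = {1,2}
  typs12 : {m : ℕ} → Word m → Word m → Bool
  typs12 x y = (allV1 x ∧ allV2 y) ∨ (allV2 x ∧ allV1 y)

  allE : {m : ℕ} → Word m → Word m → Bool
  allE []       []       = true
  allE (a ∷ x)  (b ∷ y)  = E a b ∧ allE x y

  -- adjacency in Gₙ′: strip the longest common prefix, then test the postfixes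
  adjG′ : {n : ℕ} → Word n → Word n → Bool
  adjG′ []       []       = false
  adjG′ (a ∷ x)  (b ∷ y)  =
    if a == b then adjG′ x y else (typs12 (a ∷ x) (b ∷ y) ∧ allE (a ∷ x) (b ∷ y))

  adjR : {n : ℕ} → Word n → Word n → Bool
  adjR []                []                = false
  adjR (a ∷ [])          (b ∷ [])          = RE a b
  adjR (a ∷ x@(_ ∷ _))   (b ∷ y@(_ ∷ _))   = (a == b) ∧ adjR x y

  adjHat : {n : ℕ} → Word n → Word n → Bool
  adjHat x y = not (does (VecP.≡-dec Fin._≟_ x y)) ∧ (adjG′ x y ∨ adjR x y)

  neighbours : {n : ℕ} → Word n → List (Word n)
  neighbours {n} x = filterᵇ (adjHat x) (allWords n)

  degHat : {n : ℕ} → Word n → ℕ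
  degHat x = length (neighbours x)

  nbrEdges : {n : ℕ} → Word n → ℕ
  nbrEdges x = length (filterᵇ (λ p → adjHat (Data.Product.proj₁ p) (Data.Product.proj₂ p))
                                 (unorderedPairs (neighbours x)))

  -- local clustering coefficient C_x = #edges among neighbours / binom(n_x, 2)
  -- (convention: 0 when n_x < 2)
  clustering : {n : ℕ} → Word n → ℚ
  clustering x = nbrEdges x /ℚ (degHat x C 2)

module Submission where

-- Write D = deg x and e = #edges among the neighbours of x, so that
-- C_x = e / C(D,2).  The proof is a double-counting argument on triangles through x.
--
--  * Upper bound.  A Gₙ′-edge joins words whose last letters lie in different
--    classes of the bipartition, so every triangle of Ĝₙ contains an RE-edge; an
--    RE-edge changes only the last letter, so each word has at most N RE-neighbours.
--    Charging triangles through x to RE-edges gives 2e ≤ 3N·D.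
--  * Lower bound.  Property R yields a letter w such that replacing the last letter
--    of any Gₙ′-neighbour y of x by w gives a neighbour of x on a triangle through x.
--    This map is at most N-to-one, so D ≤ N + N·2e; it also shows e ≥ 1, D ≥ 2.
--  * Arithmetic.  With 2·C(D,2) + D = D², these estimates become the two rational
--    inequalities.

open import Data.Bool using (Bool; true; false)
open import Data.Nat using (ℕ; _≤_)
open import Data.Fin using (Fin)
open import Relation.Binary.PropositionalEquality using (_≡_; _≢_)

module Counting where

  open import Data.Bool using (Bool; true; false; _∧_)
  open import Data.Nat using (ℕ; zero; suc; _+_; _*_; _≤_; z≤n; s≤s)
  open import Data.Nat.Properties hiding (_≟_)
  open import Data.Fin using (Fin; zero; suc; _≟_)
  open import Data.List using (List; []; _∷_; map; concatMap; filterᵇ; length; _++_; tabulate)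
  open import Data.Product using (_×_; _,_; proj₁; proj₂)
  open import Data.Nat.Tactic.RingSolver using (solve-∀)
  open import Relation.Nullary using (does)
  open import Relation.Binary.PropositionalEquality
  open import Defs using (unorderedPairs)

  ⟦_⟧ : Bool → ℕ
  ⟦ true ⟧  = 1
  ⟦ false ⟧ = 0

  ⟦⟧≤1 : ∀ b → ⟦ b ⟧ ≤ 1
  ⟦⟧≤1 true  = s≤s z≤n
  ⟦⟧≤1 false = z≤n

  ⟦∧⟧ : ∀ p q → ⟦ p ∧ q ⟧ ≡ ⟦ p ⟧ * ⟦ q ⟧
  ⟦∧⟧ true  q = sym (+-identityʳ ⟦ q ⟧)
  ⟦∧⟧ false q = refl

  ∑∈ : {A : Set} → List A → (A → ℕ) → ℕ
  ∑∈ []       g = 0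
  ∑∈ (a ∷ as) g = g a + ∑∈ as g

  infix 5 ∑∈
  syntax ∑∈ L (λ a → g) = ∑[ a ∈ L ] g

  ∑∈-cong : {A : Set} (L : List A) {g h : A → ℕ} → (∀ a → g a ≡ h a) → ∑∈ L g ≡ ∑∈ L h
  ∑∈-cong []      g≡h = refl
  ∑∈-cong (a ∷ L) g≡h = cong₂ _+_ (g≡h a) (∑∈-cong L g≡h)

  ∑∈-++ : {A : Set} (L M : List A) (g : A → ℕ) → ∑∈ (L ++ M) g ≡ ∑∈ L g + ∑∈ M g
  ∑∈-++ []      M g = refl
  ∑∈-++ (a ∷ L) M g = trans (cong (g a +_) (∑∈-++ L M g)) (sym (+-assoc (g a) _ _))

  ∑∈-map : {A B : Set} (f : A → B) (L : List A) (g : B → ℕ) → ∑∈ (map f L) g ≡ ∑[ a ∈ L ] g (f a)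
  ∑∈-map f []      g = refl
  ∑∈-map f (a ∷ L) g = cong (g (f a) +_) (∑∈-map f L g)

  ∑∈-concatMap : {A B : Set} (F : A → List B) (L : List A) (g : B → ℕ) →
                 ∑∈ (concatMap F L) g ≡ ∑[ a ∈ L ] ∑∈ (F a) g
  ∑∈-concatMap F []      g = refl
  ∑∈-concatMap F (a ∷ L) g =
    trans (∑∈-++ (F a) (concatMap F L) g) (cong (∑∈ (F a) g +_) (∑∈-concatMap F L g))

  ∑∈-+ : {A : Set} (L : List A) (g h : A → ℕ) → ∑[ a ∈ L ] (g a + h a) ≡ ∑∈ L g + ∑∈ L h
  ∑∈-+ []      g h = refl
  ∑∈-+ (a ∷ L) g h = trans (cong (g a + h a +_) (∑∈-+ L g h)) (interchange (g a) (h a) _ _)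
    where interchange : ∀ a b c d → a + b + (c + d) ≡ a + c + (b + d)
          interchange = solve-∀

  ∑∈-* : {A : Set} (L : List A) (c : ℕ) (g : A → ℕ) → ∑[ a ∈ L ] c * g a ≡ c * ∑∈ L g
  ∑∈-* []      c g = sym (*-zeroʳ c)
  ∑∈-* (a ∷ L) c g = trans (cong (c * g a +_) (∑∈-* L c g)) (sym (*-distribˡ-+ c (g a) _))

  ∑∈-mono : {A : Set} (L : List A) {g h : A → ℕ} → (∀ a → g a ≤ h a) → ∑∈ L g ≤ ∑∈ L h
  ∑∈-mono []      g≤h = z≤n
  ∑∈-mono (a ∷ L) g≤h = +-mono-≤ (g≤h a) (∑∈-mono L g≤h)

  length-filterᵇ : {A : Set} (p : A → Bool) (L : List A) → length (filterᵇ p L) ≡ ∑[ a ∈ L ] ⟦ p a ⟧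
  length-filterᵇ p []      = refl
  length-filterᵇ p (a ∷ L) with p a
  ... | true  = cong suc (length-filterᵇ p L)
  ... | false = length-filterᵇ p L

  ∑∈-filterᵇ : {A : Set} (p : A → Bool) (L : List A) (g : A → ℕ) →
               ∑∈ (filterᵇ p L) g ≡ ∑[ a ∈ L ] ⟦ p a ⟧ * g a
  ∑∈-filterᵇ p []      g = refl
  ∑∈-filterᵇ p (a ∷ L) g with p a
  ... | true  = cong₂ _+_ (sym (+-identityʳ (g a))) (∑∈-filterᵇ p L g)
  ... | false = ∑∈-filterᵇ p L g

  ∑-unorderedPairs : {A : Set} (Q : A → A → Bool) → (∀ a b → Q a b ≡ Q b a) → (∀ a → Q a a ≡ false) →
    (L : List A) → 2 * (∑[ p ∈ unorderedPairs L ] ⟦ Q (proj₁ p) (proj₂ p) ⟧) ≡ ∑[ a ∈ L ] ∑[ b ∈ L ] ⟦ Q a b ⟧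
  ∑-unorderedPairs Q Q-sym Q-irr [] = refl
  ∑-unorderedPairs {A} Q Q-sym Q-irr (a ∷ L) = begin
      2 * ∑∈ (map (a ,_) L ++ unorderedPairs L) q
    ≡⟨ cong (2 *_) (trans (∑∈-++ (map (a ,_) L) (unorderedPairs L) q)
                          (cong (_+ pairs) (∑∈-map (a ,_) L q))) ⟩
      2 * (row + pairs)
    ≡⟨ double row pairs ⟩
      row + (row + 2 * pairs)
    ≡⟨ cong₂ (λ s t → s + (t + 2 * pairs)) (cong (λ b → ⟦ b ⟧ + row) (sym (Q-irr a)))
                                            (∑∈-cong L (λ b → cong ⟦_⟧ (Q-sym a b))) ⟩
      ⟦ Q a a ⟧ + row + (column + 2 * pairs)
    ≡⟨ cong (λ t → ⟦ Q a a ⟧ + row + (column + t)) (∑-unorderedPairs Q Q-sym Q-irr L) ⟩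
      ⟦ Q a a ⟧ + row + (column + (∑[ b ∈ L ] ∑[ c ∈ L ] ⟦ Q b c ⟧))
    ≡⟨ cong (⟦ Q a a ⟧ + row +_) (sym (∑∈-+ L (λ b → ⟦ Q b a ⟧) (λ b → ∑[ c ∈ L ] ⟦ Q b c ⟧))) ⟩
      ⟦ Q a a ⟧ + row + (∑[ b ∈ L ] (⟦ Q b a ⟧ + (∑[ c ∈ L ] ⟦ Q b c ⟧)))
    ∎
    where
      open ≡-Reasoning
      q : A × A → ℕ
      q p = ⟦ Q (proj₁ p) (proj₂ p) ⟧
      pairs row column : ℕ
      pairs  = ∑∈ (unorderedPairs L) q
      row    = ∑[ b ∈ L ] ⟦ Q a b ⟧
      column = ∑[ b ∈ L ] ⟦ Q b a ⟧
      double : ∀ x y → 2 * (x + y) ≡ x + (x + 2 * y)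
      double = solve-∀

  unorderedPairs-length : {A : Set} (P : A × A → Bool) (L : List A) →
                          1 ≤ length (filterᵇ P (unorderedPairs L)) → 2 ≤ length L
  unorderedPairs-length P []          ()
  unorderedPairs-length P (a ∷ [])    ()
  unorderedPairs-length P (a ∷ b ∷ L) _ = s≤s (s≤s z≤n)

  ∑< : (k : ℕ) → (Fin k → ℕ) → ℕ
  ∑< zero    g = 0
  ∑< (suc k) g = g zero + ∑< k (λ i → g (suc i))

  infix 5 ∑<
  syntax ∑< k (λ i → g) = ∑[ i < k ] g

  ∑∈-tabulate : {A : Set} (k : ℕ) (f : Fin k → A) (g : A → ℕ) → ∑∈ (tabulate f) g ≡ ∑[ i < k ] g (f i)
  ∑∈-tabulate zero    f g = refl
  ∑∈-tabulate (suc k) f g = cong (g (f zero) +_) (∑∈-tabulate k (λ i → f (suc i)) g)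

  ∑<-cong : ∀ k {g h : Fin k → ℕ} → (∀ i → g i ≡ h i) → ∑< k g ≡ ∑< k h
  ∑<-cong zero    g≡h = refl
  ∑<-cong (suc k) g≡h = cong₂ _+_ (g≡h zero) (∑<-cong k (λ i → g≡h (suc i)))

  ∑<-mono : ∀ k {g h : Fin k → ℕ} → (∀ i → g i ≤ h i) → ∑< k g ≤ ∑< k h
  ∑<-mono zero    g≤h = z≤n
  ∑<-mono (suc k) g≤h = +-mono-≤ (g≤h zero) (∑<-mono k (λ i → g≤h (suc i)))

  ∑<-* : ∀ k c (g : Fin k → ℕ) → ∑[ i < k ] c * g i ≡ c * ∑< k g
  ∑<-* zero    c g = sym (*-zeroʳ c)
  ∑<-* (suc k) c g = trans (cong (c * g zero +_) (∑<-* k c _)) (sym (*-distribˡ-+ c (g zero) _))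

  ∑<-const : ∀ k c → ∑[ i < k ] c ≡ k * c
  ∑<-const zero    c = refl
  ∑<-const (suc k) c = cong (c +_) (∑<-const k c)

  ∑<-term : ∀ k (g : Fin k → ℕ) i → g i ≤ ∑< k g
  ∑<-term (suc k) g zero    = m≤m+n (g zero) _
  ∑<-term (suc k) g (suc i) = ≤-trans (∑<-term k (λ j → g (suc j)) i) (m≤n+m _ (g zero))

  ∑<-δ : ∀ k (a : Fin k) X → ∑[ b < k ] ⟦ does (a ≟ b) ⟧ * X ≡ X
  ∑<-δ (suc k) zero    X = begin
    (X + 0) + (∑[ b < k ] 0 * X) ≡⟨ cong₂ _+_ (+-identityʳ X) (∑<-const k 0) ⟩
    X + k * 0                   ≡⟨ cong (X +_) (*-zeroʳ k) ⟩
    X + 0                       ≡⟨ +-identityʳ X ⟩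
    X                           ∎
    where open ≡-Reasoning
  ∑<-δ (suc k) (suc a) X = ∑<-δ k a X

module ClusteringArithmetic where

  open import Defs using (_/ℚ_; invℕ)
  open import Data.Nat using (ℕ; zero; suc; _+_; _*_; _≤_)
  open import Data.Nat.Properties
  open import Data.Nat.Combinatorics using (_C_; nCk+nC[k+1]≡[n+1]C[k+1]; nC1≡n)
  open import Data.Nat.Tactic.RingSolver using (solve-∀)
  open import Data.Integer as ℤ using (+≤+)
  import Data.Integer.Properties as ℤP
  open import Data.Rational using (0ℚ; _/_; toℚᵘ) renaming (_≤_ to _≤ℚ_; _<_ to _<ℚ_; _*_ to _*ℚ_)
  import Data.Rational.Properties as ℚP
  open import Data.Rational.Unnormalised as ℚᵘ using (mkℚᵘ; *≤*) renaming (_≃_ to _≃ᵘ_)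
  import Data.Rational.Unnormalised.Properties as ℚᵘP
  open import Data.Product using (_×_; _,_)
  open import Relation.Binary.PropositionalEquality

  twice-C2 : ∀ D → 2 * (D C 2) + D ≡ D * D
  twice-C2 zero    = refl
  twice-C2 (suc n) = begin
      2 * (suc n C 2) + suc n
    ≡⟨ cong (λ t → 2 * t + suc n) (sym (nCk+nC[k+1]≡[n+1]C[k+1] n 1)) ⟩
      2 * (n C 1 + n C 2) + suc n
    ≡⟨ cong (λ t → 2 * (t + n C 2) + suc n) (nC1≡n n) ⟩
      2 * (n + n C 2) + suc n
    ≡⟨ regroup n (n C 2) ⟩
      (2 * (n C 2) + n) + (2 * n + 1)
    ≡⟨ cong (_+ (2 * n + 1)) (twice-C2 n) ⟩
      n * n + (2 * n + 1)
    ≡⟨ square-suc n ⟩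
      suc n * suc n
    ∎
    where
      open ≡-Reasoning
      regroup : ∀ n c → 2 * (n + c) + suc n ≡ (2 * c + n) + (2 * n + 1)
      regroup = solve-∀
      square-suc : ∀ n → n * n + (2 * n + 1) ≡ suc n * suc n
      square-suc = solve-∀

  -- Natural-number form of the lower bound e / C(D,2) ≥ 1 / ((1+4N)·D):
  -- D ≤ N(1 + 2e) ≤ 4Ne, so C(D,2) ≤ D² ≤ 4NeD.
  lower-ℕ : ∀ N D e c → D ≤ N + N * (2 * e) → 1 ≤ e → 2 * c + D ≡ D * D → c ≤ e * ((1 + 4 * N) * D)
  lower-ℕ N D e c D≤ 1≤e c-eq = begin
      c               ≤⟨ ≤-trans (m≤n*m c 2) (m≤m+n (2 * c) D) ⟩
      2 * c + D       ≡⟨ c-eq ⟩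
      D * D           ≤⟨ *-monoˡ-≤ D D≤4Ne ⟩
      N * (4 * e) * D ≡⟨ regroup N e D ⟩
      e * (4 * N * D) ≤⟨ *-monoʳ-≤ e (*-monoˡ-≤ D (n≤1+n (4 * N))) ⟩
      e * ((1 + 4 * N) * D) ∎
    where
      open ≤-Reasoning
      regroup : ∀ N e D → N * (4 * e) * D ≡ e * (4 * N * D)
      regroup = solve-∀
      D≤4Ne : D ≤ N * (4 * e)
      D≤4Ne = begin
        D               ≤⟨ D≤ ⟩
        N + N * (2 * e) ≡⟨ factor N e ⟩
        N * (1 + 2 * e) ≤⟨ *-monoʳ-≤ N (+-monoˡ-≤ (2 * e) (≤-trans 1≤e (m≤m+n e (e + 0)))) ⟩
        N * (2 * e + 2 * e) ≡⟨ cong (N *_) (double e) ⟩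
        N * (4 * e)     ∎
        where
          factor : ∀ N e → N + N * (2 * e) ≡ N * (1 + 2 * e)
          factor = solve-∀
          double : ∀ e → 2 * e + 2 * e ≡ 4 * e
          double = solve-∀

  D≤2C : ∀ D c → 2 ≤ D → 2 * c + D ≡ D * D → D ≤ 2 * c
  D≤2C D c 2≤D c-eq = +-cancelʳ-≤ D D (2 * c) (begin
      D + D     ≡⟨ cong (D +_) (sym (+-identityʳ D)) ⟩
      2 * D     ≤⟨ *-monoˡ-≤ D 2≤D ⟩
      D * D     ≡⟨ sym c-eq ⟩
      2 * c + D ∎)
    where open ≤-Reasoning

  -- Natural-number form of the upper bound e / C(D,2) ≤ (1+6N) / D:
  -- D ≤ 2·C(D,2) gives D² ≤ 4·C(D,2), and 2eD ≤ 3N·D² ≤ 12N·C(D,2).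
  upper-ℕ : ∀ N D e c → 2 ≤ D → 2 * e ≤ 3 * N * D → 2 * c + D ≡ D * D → e * D ≤ (1 + 6 * N) * c
  upper-ℕ N D e c 2≤D 2e≤3ND c-eq =
    ≤-trans (*-cancelˡ-≤ 2 twice-eD≤twice-6Nc) (*-monoˡ-≤ c (n≤1+n (6 * N)))
    where
      open ≤-Reasoning
      D²≤4c : D * D ≤ 4 * c
      D²≤4c = begin
        D * D         ≡⟨ sym c-eq ⟩
        2 * c + D     ≤⟨ +-monoʳ-≤ (2 * c) (D≤2C D c 2≤D c-eq) ⟩
        2 * c + 2 * c ≡⟨ double c ⟩
        4 * c         ∎
        where double : ∀ c → 2 * c + 2 * c ≡ 4 * c
              double = solve-∀
      twice-eD≤twice-6Nc : 2 * (e * D) ≤ 2 * (6 * N * c)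
      twice-eD≤twice-6Nc = begin
        2 * (e * D)       ≡⟨ *-assoc 2 e D ⟨
        2 * e * D         ≤⟨ *-monoˡ-≤ D 2e≤3ND ⟩
        3 * N * D * D     ≡⟨ *-assoc (3 * N) D D ⟩
        3 * N * (D * D)   ≤⟨ *-monoʳ-≤ (3 * N) D²≤4c ⟩
        3 * N * (4 * c)   ≡⟨ regroup N c ⟩
        2 * (6 * N * c)   ∎
        where regroup : ∀ N c → 3 * N * (4 * c) ≡ 2 * (6 * N * c)
              regroup = solve-∀

  toℚᵘ-/ : ∀ i b → toℚᵘ (i / suc b) ≃ᵘ mkℚᵘ i b
  toℚᵘ-/ i b = ℚP.toℚᵘ-fromℚᵘ (mkℚᵘ i b)

  /-* : ∀ a b c d → ((ℤ.+ a) / suc b) *ℚ ((ℤ.+ c) / suc d) ≡ (ℤ.+ (a * c)) / (suc b * suc d)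
  /-* a b c d = ℚP.toℚᵘ-injective (begin-equality
      toℚᵘ (((ℤ.+ a) / suc b) *ℚ ((ℤ.+ c) / suc d))
    ≃⟨ ℚP.toℚᵘ-homo-* ((ℤ.+ a) / suc b) ((ℤ.+ c) / suc d) ⟩
      toℚᵘ ((ℤ.+ a) / suc b) ℚᵘ.* toℚᵘ ((ℤ.+ c) / suc d)
    ≃⟨ ℚᵘP.*-cong (toℚᵘ-/ (ℤ.+ a) b) (toℚᵘ-/ (ℤ.+ c) d) ⟩
      mkℚᵘ (ℤ.+ a ℤ.* ℤ.+ c) (d + b * suc d)
    ≡⟨ cong (λ i → mkℚᵘ i (d + b * suc d)) (ℤP.pos-* a c) ⟨
      mkℚᵘ (ℤ.+ (a * c)) (d + b * suc d)
    ≃⟨ toℚᵘ-/ (ℤ.+ (a * c)) (d + b * suc d) ⟨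
      toℚᵘ ((ℤ.+ (a * c)) / (suc b * suc d))
    ∎)
    where open ℚᵘP.≤-Reasoning

  /-≤ : ∀ a b c d → a * suc d ≤ c * suc b → (ℤ.+ a) / suc b ≤ℚ (ℤ.+ c) / suc d
  /-≤ a b c d ad≤cb = ℚP.toℚᵘ-cancel-≤ (begin
      toℚᵘ ((ℤ.+ a) / suc b) ≃⟨ toℚᵘ-/ (ℤ.+ a) b ⟩
      mkℚᵘ (ℤ.+ a) b         ≤⟨ *≤* (subst₂ ℤ._≤_ (ℤP.pos-* a (suc d)) (ℤP.pos-* c (suc b)) (+≤+ ad≤cb)) ⟩
      mkℚᵘ (ℤ.+ c) d         ≃⟨ toℚᵘ-/ (ℤ.+ c) d ⟨
      toℚᵘ ((ℤ.+ c) / suc d) ∎)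
    where open ℚᵘP.≤-Reasoning

  positive-fraction : ∀ a b → 0ℚ <ℚ (ℤ.+ suc a) / suc b
  positive-fraction a b = ℚP.positive⁻¹ _ {{ℚP.normalize-pos (suc a) (suc b)}}

  record CountingBounds (N D e : ℕ) : Set where
    field
      degree≤   : D ≤ N + N * (2 * e)
      edges≥1   : 1 ≤ e
      edges≤    : 2 * e ≤ 3 * N * D
      degree≥2  : 2 ≤ D

  clusteringBounds : ∀ {N D e} → CountingBounds N D e →
    (((ℤ.+ 1) / suc (4 * N)) *ℚ invℕ D ≤ℚ e /ℚ (D C 2)) ×
    (e /ℚ (D C 2) ≤ℚ ((ℤ.+ suc (6 * N)) / 1) *ℚ invℕ D)
  clusteringBounds {N} {D@(suc d)} {e} bounds = fromPairs (D C 2) (twice-C2 D)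
    where
      open CountingBounds bounds
      fromPairs : ∀ c → 2 * c + D ≡ D * D →
        (((ℤ.+ 1) / suc (4 * N)) *ℚ invℕ D ≤ℚ e /ℚ c) × (e /ℚ c ≤ℚ ((ℤ.+ suc (6 * N)) / 1) *ℚ invℕ D)
      fromPairs zero    c-eq with () ← D≤2C D 0 degree≥2 c-eq
      fromPairs (suc c) c-eq = lowerBound , upperBound
        where
          open ℚP.≤-Reasoning
          lowerBound : ((ℤ.+ 1) / suc (4 * N)) *ℚ ((ℤ.+ 1) / D) ≤ℚ (ℤ.+ e) / suc c
          lowerBound = begin
            ((ℤ.+ 1) / suc (4 * N)) *ℚ ((ℤ.+ 1) / D) ≡⟨ /-* 1 (4 * N) 1 d ⟩
            (ℤ.+ 1) / (suc (4 * N) * D)              ≤⟨ /-≤ 1 _ e c (≤-trans (≤-reflexive (*-identityˡ (suc c)))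
                                                                (lower-ℕ N D e (suc c) degree≤ edges≥1 c-eq)) ⟩
            (ℤ.+ e) / suc c                          ∎
          upperBound : (ℤ.+ e) / suc c ≤ℚ ((ℤ.+ suc (6 * N)) / 1) *ℚ ((ℤ.+ 1) / D)
          upperBound = begin
            (ℤ.+ e) / suc c                              ≤⟨ /-≤ e c (suc (6 * N) * 1) (d + 0) eD≤6NC ⟩
            (ℤ.+ (suc (6 * N) * 1)) / (1 * D)            ≡⟨ /-* (suc (6 * N)) 0 1 d ⟨
            ((ℤ.+ suc (6 * N)) / 1) *ℚ ((ℤ.+ 1) / D)     ∎
            where
              eD≤6NC : e * suc (d + 0) ≤ suc (6 * N) * 1 * suc c
              eD≤6NC = subst₂ (λ u v → e * suc u ≤ v * suc c) (sym (+-identityʳ d)) (sym (*-identityʳ (suc (6 * N))))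
                         (upper-ℕ N D e (suc c) degree≥2 edges≤ c-eq)

module Booleans where

  open import Data.Bool using (Bool; true; false; _∧_; _∨_)
  open import Data.Bool.Properties using (∨-zeroʳ; ¬-not)
  open import Data.Product using (_×_; _,_)
  open import Data.Sum using (_⊎_; inj₁; inj₂)
  open import Relation.Binary.PropositionalEquality

  ∧-elim : ∀ {a b} → a ∧ b ≡ true → a ≡ true × b ≡ true
  ∧-elim {true} {true} _ = refl , refl

  ∧-intro : ∀ {a b} → a ≡ true → b ≡ true → a ∧ b ≡ true
  ∧-intro refl refl = refl

  ∨-elim : ∀ {a b} → a ∨ b ≡ true → a ≡ true ⊎ b ≡ true
  ∨-elim {true}  _ = inj₁ refl
  ∨-elim {false} h = inj₂ h

  ∨-introˡ : ∀ {a} b → a ≡ true → a ∨ b ≡ true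
  ∨-introˡ b refl = refl

  ∨-introʳ : ∀ a {b} → b ≡ true → a ∨ b ≡ true
  ∨-introʳ a refl = ∨-zeroʳ a

  true≢false : true ≢ false
  true≢false ()

  ≢-≢⇒≡ : ∀ {p q r : Bool} → p ≢ q → q ≢ r → p ≡ r
  ≢-≢⇒≡ p≢q q≢r = trans (¬-not p≢q) (sym (¬-not (≢-sym q≢r)))

module Words {N : ℕ} (part : Fin N → Bool) (E RE : Fin N → Fin N → Bool)
  (E-sym : ∀ a b → E a b ≡ E b a) (E-bipartite : ∀ a b → E a b ≡ true → part a ≢ part b)
  (RE-sym : ∀ a b → RE a b ≡ RE b a) (RE-irrefl : ∀ a → RE a a ≡ false) where

  open import Defs using (module Hat; unorderedPairs)
  open import Data.Bool using (true; false; _∧_; _∨_; not)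
  open import Data.Bool.Properties using (∧-comm; ∨-comm; ¬-not; not-injective)
  open import Data.Nat using (zero; suc; _+_; _*_; z≤n; s≤s)
  open import Data.Nat.Properties hiding (_≟_)
  open import Data.Nat.Tactic.RingSolver using (solve-∀)
  open import Data.Fin using (_≟_; fromℕ)
  open import Data.Vec using ([]; _∷_; last; _[_]≔_)
  import Data.Vec.Properties as Vecₚ
  open import Data.List using (List; map; concatMap; allFin)
  open import Data.Product using (Σ; ∃; _×_; _,_; proj₁; proj₂)
  open import Data.Sum using (_⊎_; inj₁; inj₂)
  open import Data.Empty using (⊥-elim)
  open import Function.Bundles using (mk⇔)
  open import Relation.Nullary using (does)
  open import Relation.Nullary.Decidable using (dec-true; dec-false; does-⇔)
  open import Relation.Binary.PropositionalEquality
  open Booleans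
  open Counting
  open ClusteringArithmetic using (CountingBounds)

  open Hat part E RE

  ==-refl : ∀ a → (a == a) ≡ true
  ==-refl a = dec-true (a ≟ a) refl

  ==-sym : ∀ a b → (a == b) ≡ (b == a)
  ==-sym a b = does-⇔ (mk⇔ sym sym) (a ≟ b) (b ≟ a)

  E-irrefl : ∀ {a b} → E a b ≡ true → (a == b) ≡ false
  E-irrefl {a} {b} e = dec-false (a ≟ b) (λ a≡b → E-bipartite a b e (cong part a≡b))

  withLast : ∀ {n} → Word (suc n) → Fin N → Word (suc n)
  withLast {n} y c = y [ fromℕ n ]≔ c

  withLast-last : ∀ {n} (y : Word (suc n)) → withLast y (last y) ≡ y
  withLast-last {zero}  (a ∷ []) = refl
  withLast-last {suc n} (a ∷ y)  = cong (a ∷_) (withLast-last y)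

  allV1-last : ∀ {n} (w : Word (suc n)) → allV1 w ≡ true → part (last w) ≡ true
  allV1-last {zero}  (a ∷ []) h = proj₁ (∧-elim h)
  allV1-last {suc n} (a ∷ w)  h = allV1-last w (proj₂ (∧-elim {part a} h))

  allV2-last : ∀ {n} (w : Word (suc n)) → allV2 w ≡ true → part (last w) ≡ false
  allV2-last {zero}  (a ∷ []) h = not-injective (proj₁ (∧-elim h))
  allV2-last {suc n} (a ∷ w)  h = allV2-last w (proj₂ (∧-elim {not (part a)} h))

  allV1-withLast : ∀ {n} (w : Word (suc n)) c → allV1 w ≡ true → part c ≡ true → allV1 (withLast w c) ≡ true
  allV1-withLast {zero}  (a ∷ []) c _ pc = ∧-intro pc refl
  allV1-withLast {suc n} (a ∷ w)  c h pc = let pa , hw = ∧-elim {part a} h in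
    ∧-intro pa (allV1-withLast w c hw pc)

  allV2-withLast : ∀ {n} (w : Word (suc n)) c → allV2 w ≡ true → part c ≡ false → allV2 (withLast w c) ≡ true
  allV2-withLast {zero}  (a ∷ []) c _ pc = ∧-intro (cong not pc) refl
  allV2-withLast {suc n} (a ∷ w)  c h pc = let pa , hw = ∧-elim {not (part a)} h in
    ∧-intro pa (allV2-withLast w c hw pc)

  allE-withLast : ∀ {n} (x y : Word (suc n)) u w → allE x y ≡ true → E u w ≡ true →
                  allE (withLast x u) (withLast y w) ≡ true
  allE-withLast {zero}  (a ∷ []) (b ∷ []) u w _ e = ∧-intro e refl
  allE-withLast {suc n} (a ∷ x)  (b ∷ y)  u w h e = let eab , hxy = ∧-elim {E a b} h in
    ∧-intro eab (allE-withLast x y u w hxy e)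

  typs12-last : ∀ {n} (x y : Word (suc n)) → typs12 x y ≡ true → part (last x) ≢ part (last y)
  typs12-last x y h with ∨-elim {allV1 x ∧ allV2 y} h
  ... | inj₁ h₁ = let x₁ , y₂ = ∧-elim h₁ in
    λ eq → true≢false (trans (sym (allV1-last x x₁)) (trans eq (allV2-last y y₂)))
  ... | inj₂ h₂ = let x₂ , y₁ = ∧-elim h₂ in
    λ eq → true≢false (trans (sym (allV1-last y y₁)) (trans (sym eq) (allV2-last x x₂)))

  typs12-withLast : ∀ {n} (x y : Word (suc n)) u w → typs12 x y ≡ true → part u ≡ part (last x) →
                    part w ≢ part u → typs12 (withLast x u) (withLast y w) ≡ true
  typs12-withLast x y u w h pu pw with ∨-elim {allV1 x ∧ allV2 y} h
  ... | inj₁ h₁ = let x₁ , y₂ = ∧-elim h₁ ; pu₁ = trans pu (allV1-last x x₁) in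
    ∨-introˡ _ (∧-intro (allV1-withLast x u x₁ pu₁) (allV2-withLast y w y₂ (trans (¬-not pw) (cong not pu₁))))
  ... | inj₂ h₂ = let x₂ , y₁ = ∧-elim h₂ ; pu₂ = trans pu (allV2-last x x₂) in
    ∨-introʳ _ (∧-intro (allV2-withLast x u x₂ pu₂) (allV1-withLast y w y₁ (trans (¬-not pw) (cong not pu₂))))

  typs12-single : ∀ u w → part u ≢ part w → typs12 (u ∷ []) (w ∷ []) ≡ true
  typs12-single u w ne with part u | part w
  ... | true  | false = refl
  ... | false | true  = refl
  ... | true  | true  = ⊥-elim (ne refl)
  ... | false | false = ⊥-elim (ne refl)

  adjG′-same-head : ∀ {n} a (x y : Word n) → adjG′ (a ∷ x) (a ∷ y) ≡ adjG′ x y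
  adjG′-same-head a x y rewrite ==-refl a = refl

  adjG′-distinct-head : ∀ {n} a b (x y : Word n) → (a == b) ≡ false →
                        adjG′ (a ∷ x) (b ∷ y) ≡ typs12 (a ∷ x) (b ∷ y) ∧ allE (a ∷ x) (b ∷ y)
  adjG′-distinct-head a b x y a≠b rewrite a≠b = refl

  adjG′-last : ∀ {n} (x y : Word (suc n)) → adjG′ x y ≡ true → part (last x) ≢ part (last y)
  adjG′-last {zero} (a ∷ []) (b ∷ []) h with a == b
  ... | true  = ⊥-elim (true≢false (sym h))
  ... | false = typs12-last (a ∷ []) (b ∷ []) (proj₁ (∧-elim h))
  adjG′-last {suc n} (a ∷ x) (b ∷ y) h with a == b
  ... | true  = adjG′-last x y h
  ... | false = typs12-last (a ∷ x) (b ∷ y) (proj₁ (∧-elim {typs12 (a ∷ x) (b ∷ y)} h))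

  adjR-cons : ∀ {n} a b (x y : Word (suc n)) → adjR (a ∷ x) (b ∷ y) ≡ (a == b) ∧ adjR x y
  adjR-cons a b (_ ∷ _) (_ ∷ _) = refl

  adjR-irrefl : ∀ {n} (x : Word (suc n)) → adjR x x ≡ false
  adjR-irrefl {zero}  (a ∷ []) = RE-irrefl a
  adjR-irrefl {suc n} (a ∷ x)  = trans (adjR-cons a a x x) (cong₂ _∧_ (==-refl a) (adjR-irrefl x))

  typs12-sym : ∀ {n} (x y : Word n) → typs12 x y ≡ typs12 y x
  typs12-sym x y = trans (∨-comm (allV1 x ∧ allV2 y) (allV2 x ∧ allV1 y))
    (cong₂ _∨_ (∧-comm (allV2 x) (allV1 y)) (∧-comm (allV1 x) (allV2 y)))

  allE-sym : ∀ {n} (x y : Word n) → allE x y ≡ allE y x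
  allE-sym []      []      = refl
  allE-sym (a ∷ x) (b ∷ y) = cong₂ _∧_ (E-sym a b) (allE-sym x y)

  adjG′-sym : ∀ {n} (x y : Word n) → adjG′ x y ≡ adjG′ y x
  adjG′-sym []      []      = refl
  adjG′-sym (a ∷ x) (b ∷ y) rewrite ==-sym a b with b == a
  ... | true  = adjG′-sym x y
  ... | false = cong₂ _∧_ (typs12-sym (a ∷ x) (b ∷ y)) (allE-sym (a ∷ x) (b ∷ y))

  adjR-sym : ∀ {n} (x y : Word n) → adjR x y ≡ adjR y x
  adjR-sym []                 []                 = refl
  adjR-sym (a ∷ [])           (b ∷ [])           = RE-sym a b
  adjR-sym (a ∷ x@(_ ∷ _))    (b ∷ y@(_ ∷ _))    = cong₂ _∧_ (==-sym a b) (adjR-sym x y)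

  adjHat-sym : ∀ {n} (x y : Word n) → adjHat x y ≡ adjHat y x
  adjHat-sym x y = cong₂ (λ d b → not d ∧ b) (does-⇔ (mk⇔ sym sym) (Vecₚ.≡-dec _≟_ x y) (Vecₚ.≡-dec _≟_ y x))
                                              (cong₂ _∨_ (adjG′-sym x y) (adjR-sym x y))

  adjHat-irrefl : ∀ {n} (x : Word n) → adjHat x x ≡ false
  adjHat-irrefl x = cong (λ d → not d ∧ (adjG′ x x ∨ adjR x x)) (dec-true (Vecₚ.≡-dec _≟_ x x) refl)

  adjHat-cases : ∀ {n} (x y : Word n) → adjHat x y ≡ true → adjG′ x y ≡ true ⊎ adjR x y ≡ true
  adjHat-cases x y h = ∨-elim (proj₂ (∧-elim {not (does (Vecₚ.≡-dec _≟_ x y))} h))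

  adjHat-intro : ∀ {n} (x y : Word n) → x ≢ y → (adjG′ x y ∨ adjR x y) ≡ true → adjHat x y ≡ true
  adjHat-intro x y x≢y h = trans (cong (λ d → not d ∧ (adjG′ x y ∨ adjR x y)) (dec-false (Vecₚ.≡-dec _≟_ x y) x≢y)) h

  adjG′⇒adjHat : ∀ {n} (x y : Word (suc n)) → adjG′ x y ≡ true → adjHat x y ≡ true
  adjG′⇒adjHat x y h = adjHat-intro x y (λ { refl → adjG′-last x x h refl }) (∨-introˡ (adjR x y) h)

  adjR⇒adjHat : ∀ {n} (x y : Word (suc n)) → adjR x y ≡ true → adjHat x y ≡ true
  adjR⇒adjHat x y h = adjHat-intro x y (λ { refl → true≢false (trans (sym h) (adjR-irrefl x)) }) (∨-introʳ (adjG′ x y) h)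

  -- Every triangle of Ĝₙ contains an RE-edge: three Gₙ′-edges would force the
  -- three last letters into pairwise different classes.
  triangle-has-RE : ∀ {n} (x y z : Word (suc n)) → adjHat x y ≡ true → adjHat x z ≡ true → adjHat y z ≡ true →
                    adjR x y ≡ true ⊎ adjR x z ≡ true ⊎ adjR y z ≡ true
  triangle-has-RE x y z xy xz yz with adjHat-cases x y xy | adjHat-cases x z xz | adjHat-cases y z yz
  ... | inj₂ r | _      | _      = inj₁ r
  ... | inj₁ _ | inj₂ r | _      = inj₂ (inj₁ r)
  ... | inj₁ _ | inj₁ _ | inj₂ r = inj₂ (inj₂ r)
  ... | inj₁ g | inj₁ h | inj₁ k =
    ⊥-elim (adjG′-last x z h (≢-≢⇒≡ (adjG′-last x y g) (adjG′-last y z k)))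

  adjG′-single : ∀ {u w} → E u w ≡ true → adjG′ (u ∷ []) (w ∷ []) ≡ true
  adjG′-single {u} {w} e = trans (adjG′-distinct-head u w [] [] (E-irrefl e))
    (∧-intro (typs12-single u w (E-bipartite u w e)) (∧-intro e refl))

  adjG′-withLast-self : ∀ {n} (x : Word (suc n)) w → E (last x) w ≡ true → adjG′ x (withLast x w) ≡ true
  adjG′-withLast-self {zero}  (a ∷ []) w e = adjG′-single e
  adjG′-withLast-self {suc n} (a ∷ x)  w e = trans (adjG′-same-head a x (withLast x w)) (adjG′-withLast-self x w e)

  adjG′-withLast : ∀ {n} (x y : Word (suc n)) u w → adjG′ x y ≡ true → E u w ≡ true →
                   part u ≡ part (last x) → adjG′ (withLast x u) (withLast y w) ≡ true
  adjG′-withLast {zero}  (a ∷ []) (b ∷ []) u w _ e _ = adjG′-single e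
  adjG′-withLast {suc n} (a ∷ x)  (b ∷ y)  u w h e pu with a == b
  ... | true  = adjG′-withLast x y u w h e pu
  ... | false = let types , edges = ∧-elim {typs12 (a ∷ x) (b ∷ y)} h in
    ∧-intro (typs12-withLast (a ∷ x) (b ∷ y) u w types pu (λ pw≡pu → E-bipartite u w e (sym pw≡pu)))
            (allE-withLast (a ∷ x) (b ∷ y) u w edges e)

  adjR-withLast₂ : ∀ {n} (y : Word (suc n)) w w′ → adjR (withLast y w) (withLast y w′) ≡ RE w w′
  adjR-withLast₂ {zero}  (a ∷ []) w w′ = refl
  adjR-withLast₂ {suc n} (a ∷ y)  w w′ =
    trans (adjR-cons a a (withLast y w) (withLast y w′)) (cong₂ _∧_ (==-refl a) (adjR-withLast₂ y w w′))

  adjR-withLast : ∀ {n} (y : Word (suc n)) v → adjR y (withLast y v) ≡ RE (last y) v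
  adjR-withLast y v = subst (λ t → adjR t (withLast y v) ≡ RE (last y) v) (withLast-last y) (adjR-withLast₂ y (last y) v)

  PropertyR : Set
  PropertyR = ∀ a → ∃ λ b → ∃ λ c →
      (E a b ≡ true × E a c ≡ true × RE b c ≡ true)
    ⊎ (E a b ≡ true × E b c ≡ true × RE a c ≡ true)
    ⊎ (E a c ≡ true × E b c ≡ true × RE a b ≡ true)

  OnTriangle : ∀ {n} → Word n → Word n → Set
  OnTriangle x u = adjHat x u ≡ true × ∃ λ z → adjHat x z ≡ true × adjHat u z ≡ true

  ShiftLetter : ∀ {n} → Word (suc n) → Set
  ShiftLetter x = Σ (Fin N) λ w → E (last x) w ≡ true × (∀ y → adjG′ x y ≡ true → OnTriangle x (withLast y w))

  shift-adjacent : ∀ {n} (x y : Word (suc n)) w → adjG′ x y ≡ true → E (last x) w ≡ true → adjHat x (withLast y w) ≡ true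
  shift-adjacent x y w h e = adjG′⇒adjHat x (withLast y w)
    (subst (λ t → adjG′ t (withLast y w) ≡ true) (withLast-last x) (adjG′-withLast x y (last x) w h e refl))

  -- Case of Property R with a path a – w – v in G and an extra edge {a, v}:
  -- the third vertex of the triangle is x with last letter replaced by v.
  pathShift : ∀ {n} (x : Word (suc n)) w v → E (last x) w ≡ true → E w v ≡ true → RE (last x) v ≡ true → ShiftLetter x
  pathShift x w v e₁ e₂ r = w , e₁ , λ y h →
      shift-adjacent x y w h e₁
    , withLast x v
    , adjR⇒adjHat x (withLast x v) (trans (adjR-withLast x v) r)
    , adjG′⇒adjHat (withLast y w) (withLast x v)
        (trans (adjG′-sym (withLast y w) (withLast x v)) (adjG′-withLast x y v w h (trans (E-sym v w) e₂) pv))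
    where
      pv : part v ≡ part (last x)
      pv = ≢-≢⇒≡ (E-bipartite v w (trans (E-sym v w) e₂)) (E-bipartite w (last x) (trans (E-sym w (last x)) e₁))

  shiftLetter : PropertyR → ∀ {n} (x : Word (suc n)) → ShiftLetter x
  shiftLetter R x with R (last x)
  ... | b , c , inj₁ (e₁ , e₂ , r) = b , e₁ , λ y h →
      shift-adjacent x y b h e₁
    , withLast y c
    , shift-adjacent x y c h e₂
    , adjR⇒adjHat (withLast y b) (withLast y c) (trans (adjR-withLast₂ y b c) r)
  ... | b , c , inj₂ (inj₁ (e₁ , e₂ , r)) = pathShift x b c e₁ e₂ r
  ... | b , c , inj₂ (inj₂ (e₁ , e₂ , r)) = pathShift x c b e₁ (trans (E-sym c b) e₂) r

  ∑-allWords-suc : ∀ n (g : Word (suc n) → ℕ) →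
                   ∑∈ (allWords (suc n)) g ≡ ∑[ a < N ] ∑[ y ∈ allWords n ] g (a ∷ y)
  ∑-allWords-suc n g = begin
      ∑∈ (concatMap (λ a → map (a ∷_) (allWords n)) (allFin N)) g
    ≡⟨ ∑∈-concatMap (λ a → map (a ∷_) (allWords n)) (allFin N) g ⟩
      ∑[ a ∈ allFin N ] ∑∈ (map (a ∷_) (allWords n)) g
    ≡⟨ ∑∈-tabulate N (λ a → a) (λ a → ∑∈ (map (a ∷_) (allWords n)) g) ⟩
      ∑[ a < N ] ∑∈ (map (a ∷_) (allWords n)) g
    ≡⟨ ∑<-cong N (λ a → ∑∈-map (a ∷_) (allWords n) g) ⟩
      ∑[ a < N ] ∑[ y ∈ allWords n ] g (a ∷ y)
    ∎
    where open ≡-Reasoning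

  ∑-allWords-term : ∀ n (g : Word n → ℕ) y → g y ≤ ∑∈ (allWords n) g
  ∑-allWords-term zero    g []      = m≤m+n (g []) 0
  ∑-allWords-term (suc n) g (a ∷ y) = begin
    g (a ∷ y)                                   ≤⟨ ∑-allWords-term n (λ z → g (a ∷ z)) y ⟩
    ∑[ z ∈ allWords n ] g (a ∷ z)              ≤⟨ ∑<-term N (λ b → ∑[ z ∈ allWords n ] g (b ∷ z)) a ⟩
    ∑[ b < N ] ∑[ z ∈ allWords n ] g (b ∷ z)   ≡⟨ ∑-allWords-suc n g ⟨
    ∑∈ (allWords (suc n)) g                     ∎
    where open ≤-Reasoning

  ∑-allWords-withLast : ∀ n (g : Word (suc n) → ℕ) w →
                        ∑[ y ∈ allWords (suc n) ] g (withLast y w) ≤ N * ∑∈ (allWords (suc n)) g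
  ∑-allWords-withLast zero g w = begin
    ∑[ y ∈ allWords 1 ] g (withLast y w) ≡⟨ ∑-allWords-suc 0 (λ y → g (withLast y w)) ⟩
    ∑[ a < N ] (g (w ∷ []) + 0)          ≡⟨ ∑<-const N (g (w ∷ []) + 0) ⟩
    N * (g (w ∷ []) + 0)                 ≤⟨ *-monoʳ-≤ N (∑<-term N (λ a → g (a ∷ []) + 0) w) ⟩
    N * (∑[ a < N ] (g (a ∷ []) + 0))    ≡⟨ cong (N *_) (∑-allWords-suc 0 g) ⟨
    N * ∑∈ (allWords 1) g                ∎
    where open ≤-Reasoning
  ∑-allWords-withLast (suc n) g w = begin
      ∑[ y ∈ allWords (suc (suc n)) ] g (withLast y w)
    ≡⟨ ∑-allWords-suc (suc n) (λ y → g (withLast y w)) ⟩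
      ∑[ a < N ] ∑[ y ∈ allWords (suc n) ] g (a ∷ withLast y w)
    ≤⟨ ∑<-mono N (λ a → ∑-allWords-withLast n (λ y → g (a ∷ y)) w) ⟩
      ∑[ a < N ] N * (∑[ y ∈ allWords (suc n) ] g (a ∷ y))
    ≡⟨ ∑<-* N N (λ a → ∑[ y ∈ allWords (suc n) ] g (a ∷ y)) ⟩
      N * (∑[ a < N ] ∑[ y ∈ allWords (suc n) ] g (a ∷ y))
    ≡⟨ cong (N *_) (∑-allWords-suc (suc n) g) ⟨
      N * ∑∈ (allWords (suc (suc n))) g
    ∎
    where open ≤-Reasoning

  -- Every word has at most N RE-neighbours: they differ from it only in the last letter.
  RE-degree : ∀ n (y : Word (suc n)) → ∑[ z ∈ allWords (suc n) ] ⟦ adjR y z ⟧ ≤ N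
  RE-degree zero (a ∷ []) = begin
    ∑[ z ∈ allWords 1 ] ⟦ adjR (a ∷ []) z ⟧ ≡⟨ ∑-allWords-suc 0 (λ z → ⟦ adjR (a ∷ []) z ⟧) ⟩
    ∑[ b < N ] (⟦ RE a b ⟧ + 0)            ≤⟨ ∑<-mono N (λ b → ≤-trans (≤-reflexive (+-identityʳ _)) (⟦⟧≤1 (RE a b))) ⟩
    ∑[ b < N ] 1                           ≡⟨ ∑<-const N 1 ⟩
    N * 1                                  ≡⟨ *-identityʳ N ⟩
    N                                      ∎
    where open ≤-Reasoning
  RE-degree (suc n) (a ∷ y) = begin
      ∑[ z ∈ allWords (suc (suc n)) ] ⟦ adjR (a ∷ y) z ⟧
    ≡⟨ ∑-allWords-suc (suc n) (λ z → ⟦ adjR (a ∷ y) z ⟧) ⟩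
      ∑[ b < N ] ∑[ z ∈ allWords (suc n) ] ⟦ adjR (a ∷ y) (b ∷ z) ⟧
    ≡⟨ ∑<-cong N (λ b → ∑∈-cong (allWords (suc n)) (λ z → trans (cong ⟦_⟧ (adjR-cons a b y z)) (⟦∧⟧ (a == b) (adjR y z)))) ⟩
      ∑[ b < N ] ∑[ z ∈ allWords (suc n) ] ⟦ a == b ⟧ * ⟦ adjR y z ⟧
    ≡⟨ ∑<-cong N (λ b → ∑∈-* (allWords (suc n)) ⟦ a == b ⟧ (λ z → ⟦ adjR y z ⟧)) ⟩
      ∑[ b < N ] ⟦ a == b ⟧ * (∑[ z ∈ allWords (suc n) ] ⟦ adjR y z ⟧)
    ≡⟨ ∑<-δ N a (∑[ z ∈ allWords (suc n) ] ⟦ adjR y z ⟧) ⟩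
      ∑[ z ∈ allWords (suc n) ] ⟦ adjR y z ⟧
    ≤⟨ RE-degree n y ⟩
      N
    ∎
    where open ≤-Reasoning

  degree-as-sum : ∀ {n} (x : Word n) → degHat x ≡ ∑[ y ∈ allWords n ] ⟦ adjHat x y ⟧
  degree-as-sum {n} x = length-filterᵇ (adjHat x) (allWords n)

  triangles : ∀ {n} → Word n → Word n → ℕ
  triangles {n} x u = ⟦ adjHat x u ⟧ * (∑[ z ∈ allWords n ] ⟦ adjHat x z ⟧ * ⟦ adjHat u z ⟧)

  -- Double counting: each edge between neighbours of x closes two triangles
  -- through x, one for each of its endpoints.
  edges-as-sum : ∀ {n} (x : Word n) → 2 * nbrEdges x ≡ ∑[ u ∈ allWords n ] triangles x u
  edges-as-sum {n} x = begin
      2 * nbrEdges x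
    ≡⟨ cong (2 *_) (length-filterᵇ (λ p → adjHat (proj₁ p) (proj₂ p)) (unorderedPairs (neighbours x))) ⟩
      2 * (∑[ p ∈ unorderedPairs (neighbours x) ] ⟦ adjHat (proj₁ p) (proj₂ p) ⟧)
    ≡⟨ ∑-unorderedPairs adjHat adjHat-sym adjHat-irrefl (neighbours x) ⟩
      ∑[ u ∈ neighbours x ] ∑[ z ∈ neighbours x ] ⟦ adjHat u z ⟧
    ≡⟨ ∑∈-filterᵇ (adjHat x) (allWords n) (λ u → ∑[ z ∈ neighbours x ] ⟦ adjHat u z ⟧) ⟩
      ∑[ u ∈ allWords n ] ⟦ adjHat x u ⟧ * (∑[ z ∈ neighbours x ] ⟦ adjHat u z ⟧)
    ≡⟨ ∑∈-cong (allWords n) (λ u → cong (⟦ adjHat x u ⟧ *_) (∑∈-filterᵇ (adjHat x) (allWords n) (λ z → ⟦ adjHat u z ⟧))) ⟩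
      ∑[ u ∈ allWords n ] triangles x u
    ∎
    where open ≡-Reasoning

  onTriangle⇒triangles≥1 : ∀ {n} (x u : Word n) → OnTriangle x u → 1 ≤ triangles x u
  onTriangle⇒triangles≥1 {n} x u (xu , z , xz , uz) rewrite xu = begin
    1                                                           ≡⟨ cong₂ (λ p q → ⟦ p ⟧ * ⟦ q ⟧) xz uz ⟨
    ⟦ adjHat x z ⟧ * ⟦ adjHat u z ⟧                             ≤⟨ ∑-allWords-term n (λ v → ⟦ adjHat x v ⟧ * ⟦ adjHat u v ⟧) z ⟩
    ∑[ v ∈ allWords n ] ⟦ adjHat x v ⟧ * ⟦ adjHat u v ⟧         ≡⟨ +-identityʳ _ ⟨
    1 * (∑[ v ∈ allWords n ] ⟦ adjHat x v ⟧ * ⟦ adjHat u v ⟧)   ∎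
    where open ≤-Reasoning

  ⟦adjHat⟧≤ : ∀ {n} (x y : Word n) → ⟦ adjHat x y ⟧ ≤ ⟦ adjR x y ⟧ + ⟦ adjG′ x y ⟧
  ⟦adjHat⟧≤ x y with adjHat x y in xy
  ... | false = z≤n
  ... | true with adjHat-cases x y xy
  ...   | inj₁ g rewrite g = m≤n+m 1 ⟦ adjR x y ⟧
  ...   | inj₂ r rewrite r = s≤s z≤n

  ⟦adjG′⟧≤triangles : ∀ {n} (x : Word (suc n)) (s : ShiftLetter x) y →
                      ⟦ adjG′ x y ⟧ ≤ triangles x (withLast y (proj₁ s))
  ⟦adjG′⟧≤triangles x (w , _ , shift) y with adjG′ x y in xy
  ... | false = z≤n
  ... | true  = onTriangle⇒triangles≥1 x (withLast y w) (shift y xy)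

  -- Lower bound for the clustering: the degree is at most N (RE-neighbours) plus
  -- N times the number of triangle incidences 2e (shifted Gₙ′-neighbours).
  degree-bound : ∀ {n} (x : Word (suc n)) → ShiftLetter x → degHat x ≤ N + N * (2 * nbrEdges x)
  degree-bound {n} x s@(w , _) = begin
      degHat x
    ≡⟨ degree-as-sum x ⟩
      ∑[ y ∈ allWords (suc n) ] ⟦ adjHat x y ⟧
    ≤⟨ ∑∈-mono (allWords (suc n)) (⟦adjHat⟧≤ x) ⟩
      ∑[ y ∈ allWords (suc n) ] (⟦ adjR x y ⟧ + ⟦ adjG′ x y ⟧)
    ≡⟨ ∑∈-+ (allWords (suc n)) (λ y → ⟦ adjR x y ⟧) (λ y → ⟦ adjG′ x y ⟧) ⟩
      (∑[ y ∈ allWords (suc n) ] ⟦ adjR x y ⟧) + (∑[ y ∈ allWords (suc n) ] ⟦ adjG′ x y ⟧)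
    ≤⟨ +-mono-≤ (RE-degree n x) (∑∈-mono (allWords (suc n)) (⟦adjG′⟧≤triangles x s)) ⟩
      N + (∑[ y ∈ allWords (suc n) ] triangles x (withLast y w))
    ≤⟨ +-monoʳ-≤ N (∑-allWords-withLast n (triangles x) w) ⟩
      N + N * ∑∈ (allWords (suc n)) (triangles x)
    ≡⟨ cong (λ t → N + N * t) (edges-as-sum x) ⟨
      N + N * (2 * nbrEdges x)
    ∎
    where open ≤-Reasoning

  -- x itself, shifted twice, witnesses a triangle through x.
  edges≥1 : ∀ {n} (x : Word (suc n)) → ShiftLetter x → 1 ≤ nbrEdges x
  edges≥1 {n} x s@(w , e , _) = halve (nbrEdges x) (begin
    1                                                  ≡⟨ cong ⟦_⟧ (adjG′-withLast-self x w e) ⟨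
    ⟦ adjG′ x (withLast x w) ⟧                         ≤⟨ ⟦adjG′⟧≤triangles x s (withLast x w) ⟩
    triangles x (withLast (withLast x w) w)            ≤⟨ ∑-allWords-term (suc n) (triangles x) _ ⟩
    ∑∈ (allWords (suc n)) (triangles x)                ≡⟨ edges-as-sum x ⟨
    2 * nbrEdges x                                     ∎)
    where
      open ≤-Reasoning
      halve : ∀ m → 1 ≤ 2 * m → 1 ≤ m
      halve (suc m) _ = s≤s z≤n

  -- Pointwise form of triangle-has-RE: a triangle x, y, z is charged either to
  -- the RE-edge xy or to the RE-edges at z.
  triangle-indicator : ∀ {n} (x y z : Word (suc n)) →
    ⟦ adjHat x y ⟧ * (⟦ adjHat x z ⟧ * ⟦ adjHat y z ⟧) ≤ ⟦ adjR x y ⟧ * ⟦ adjHat x z ⟧ + ⟦ adjHat x y ⟧ * (⟦ adjR x z ⟧ + ⟦ adjR y z ⟧)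
  triangle-indicator x y z with adjHat x y in xy | adjHat x z in xz | adjHat y z in yz
  ... | false | _     | _     = z≤n
  ... | true  | false | _     = z≤n
  ... | true  | true  | false = z≤n
  ... | true  | true  | true with triangle-has-RE x y z xy xz yz
  ...   | inj₁ r        rewrite r = s≤s z≤n
  ...   | inj₂ (inj₁ r) rewrite r = ≤-trans (s≤s z≤n) (m≤n+m _ (⟦ adjR x y ⟧ * 1))
  ...   | inj₂ (inj₂ r) rewrite r =
    ≤-trans (≤-trans (m≤n+m 1 ⟦ adjR x z ⟧) (m≤m+n _ 0)) (m≤n+m _ (⟦ adjR x y ⟧ * 1))

  -- Triangles through an edge xy: at most deg x if xy is an RE-edge, plus at most
  -- N + N through the RE-edges at x and at y.
  triangles-bound : ∀ {n} (x y : Word (suc n)) →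
                    triangles x y ≤ degHat x * ⟦ adjR x y ⟧ + (N + N) * ⟦ adjHat x y ⟧
  triangles-bound {n} x y = begin
      ⟦ x~y ⟧ * (∑[ z ∈ W ] ⟦ adjHat x z ⟧ * ⟦ adjHat y z ⟧)
    ≡⟨ ∑∈-* W ⟦ x~y ⟧ (λ z → ⟦ adjHat x z ⟧ * ⟦ adjHat y z ⟧) ⟨
      ∑[ z ∈ W ] ⟦ x~y ⟧ * (⟦ adjHat x z ⟧ * ⟦ adjHat y z ⟧)
    ≤⟨ ∑∈-mono W (triangle-indicator x y) ⟩
      ∑[ z ∈ W ] (⟦ adjR x y ⟧ * ⟦ adjHat x z ⟧ + ⟦ x~y ⟧ * (⟦ adjR x z ⟧ + ⟦ adjR y z ⟧))
    ≡⟨ ∑∈-+ W (λ z → ⟦ adjR x y ⟧ * ⟦ adjHat x z ⟧) (λ z → ⟦ x~y ⟧ * (⟦ adjR x z ⟧ + ⟦ adjR y z ⟧)) ⟩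
      (∑[ z ∈ W ] ⟦ adjR x y ⟧ * ⟦ adjHat x z ⟧) + (∑[ z ∈ W ] ⟦ x~y ⟧ * (⟦ adjR x z ⟧ + ⟦ adjR y z ⟧))
    ≡⟨ cong₂ _+_ (∑∈-* W ⟦ adjR x y ⟧ (λ z → ⟦ adjHat x z ⟧))
                 (trans (∑∈-* W ⟦ x~y ⟧ (λ z → ⟦ adjR x z ⟧ + ⟦ adjR y z ⟧))
                        (cong (⟦ x~y ⟧ *_) (∑∈-+ W (λ z → ⟦ adjR x z ⟧) (λ z → ⟦ adjR y z ⟧)))) ⟩
      ⟦ adjR x y ⟧ * (∑[ z ∈ W ] ⟦ adjHat x z ⟧) + ⟦ x~y ⟧ * ((∑[ z ∈ W ] ⟦ adjR x z ⟧) + (∑[ z ∈ W ] ⟦ adjR y z ⟧))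
    ≤⟨ +-mono-≤ (≤-reflexive (trans (cong (⟦ adjR x y ⟧ *_) (sym (degree-as-sum x))) (*-comm ⟦ adjR x y ⟧ (degHat x))))
                (≤-trans (*-monoʳ-≤ ⟦ x~y ⟧ (+-mono-≤ (RE-degree n x) (RE-degree n y))) (≤-reflexive (*-comm ⟦ x~y ⟧ (N + N)))) ⟩
      degHat x * ⟦ adjR x y ⟧ + (N + N) * ⟦ x~y ⟧
    ∎
    where
      open ≤-Reasoning
      W : List (Word (suc n))
      W = allWords (suc n)
      x~y : Bool
      x~y = adjHat x y

  edges-bound : ∀ {n} (x : Word (suc n)) → 2 * nbrEdges x ≤ 3 * N * degHat x
  edges-bound {n} x = begin
      2 * nbrEdges x
    ≡⟨ edges-as-sum x ⟩
      ∑[ y ∈ W ] triangles x y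
    ≤⟨ ∑∈-mono W (triangles-bound x) ⟩
      ∑[ y ∈ W ] (D * ⟦ adjR x y ⟧ + (N + N) * ⟦ adjHat x y ⟧)
    ≡⟨ ∑∈-+ W (λ y → D * ⟦ adjR x y ⟧) (λ y → (N + N) * ⟦ adjHat x y ⟧) ⟩
      (∑[ y ∈ W ] D * ⟦ adjR x y ⟧) + (∑[ y ∈ W ] (N + N) * ⟦ adjHat x y ⟧)
    ≡⟨ cong₂ _+_ (∑∈-* W D (λ y → ⟦ adjR x y ⟧))
                 (trans (∑∈-* W (N + N) (λ y → ⟦ adjHat x y ⟧)) (cong ((N + N) *_) (sym (degree-as-sum x)))) ⟩
      D * (∑[ y ∈ W ] ⟦ adjR x y ⟧) + (N + N) * D
    ≤⟨ +-monoˡ-≤ ((N + N) * D) (*-monoʳ-≤ D (RE-degree n x)) ⟩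
      D * N + (N + N) * D
    ≡⟨ collect N D ⟩
      3 * N * D
    ∎
    where
      open ≤-Reasoning
      W : List (Word (suc n))
      W = allWords (suc n)
      D : ℕ
      D = degHat x
      collect : ∀ N D → D * N + (N + N) * D ≡ 3 * N * D
      collect = solve-∀

  countingBounds : PropertyR → ∀ {n} (x : Word (suc n)) → CountingBounds N (degHat x) (nbrEdges x)
  countingBounds R x = record
    { degree≤  = degree-bound x s
    ; edges≥1  = edges≥1 x s
    ; edges≤   = edges-bound x
    ; degree≥2 = unorderedPairs-length (λ p → adjHat (proj₁ p) (proj₂ p)) (neighbours x) (edges≥1 x s)
    }
    where s = shiftLetter R x

open import Defs using (module Hat; invℕ)
open import Data.Vec using (Vec)
open import Data.Product using (Σ; ∃; _×_; _,_)
open import Data.Sum using (_⊎_)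
open import Data.Rational using (ℚ; 0ℚ; _<_; _*_; _/_) renaming (_≤_ to _≤ℚ_)
open import Data.Nat using (suc) renaming (_*_ to _*ℕ_)
open import Data.Integer using (+_)
open ClusteringArithmetic using (clusteringBounds; positive-fraction)

mainTheorem10 : (N : ℕ) (part : Fin N → Bool) (E RE : Fin N → Fin N → Bool)
    → (∀ x y → E x y ≡ E y x)
    → (∀ x y → E x y ≡ true → part x ≢ part y)
    → (∃ λ x → part x ≡ true)
    → (∃ λ x → part x ≡ false)
    → (∀ x y → RE x y ≡ RE y x)
    → (∀ x → RE x x ≡ false)
    → (∀ x → ∃ λ y → ∃ λ z →
          (E x y ≡ true × E x z ≡ true × RE y z ≡ true)
        ⊎ (E x y ≡ true × E y z ≡ true × RE x z ≡ true)
        ⊎ (E x z ≡ true × E y z ≡ true × RE x y ≡ true))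
    → Σ ℚ λ K₁ → Σ ℚ λ K₂ → 0ℚ < K₁ × 0ℚ < K₂ ×
        ((n : ℕ) → 1 ≤ n → (x : Vec (Fin N) n) →
          (K₁ * invℕ (Hat.degHat part E RE x) ≤ℚ Hat.clustering part E RE x)
          × (Hat.clustering part E RE x ≤ℚ K₂ * invℕ (Hat.degHat part E RE x)))
mainTheorem10 N part E RE E-sym E-bipartite _ _ RE-sym RE-irrefl propertyR =
    (+ 1) / suc (4 *ℕ N) , (+ suc (6 *ℕ N)) / 1
  , positive-fraction 0 (4 *ℕ N) , positive-fraction (6 *ℕ N) 0
  , λ { (suc m) _ x → clusteringBounds (countingBounds propertyR x) }
  where open Words part E RE E-sym E-bipartite RE-sym RE-irrefl using (countingBounds)
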